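{- Let $G$ be a long graph with $n$ vertices and first Betti number $2g$. Expand $R_g\in\mathcal{W}$ as $R_g=\sum_H C_H H$. Then the coefficient of $G$ in $T_n\cdot R_{g,n}$ equals the coefficient of $G$ in $T_n\cdot\sum_{H}' C_H H_n$. Here $\sum'$ is restricted to those graphs $H$ that are disjoint unions of spiders $X_k$ ($k\ge1$).
   Context: The skeleton of a connected graph with at least 2 independent cycles is obtained by repeatedly removing valency-$1$ vertices. Essential vertices are those of valency $\ge3$ in the skeleton. A long graph is a connected loopless graph (multiple edges allowed) with at least 2 independent cycles in which no two essential vertices are joined by an edge. The $k$-spider $X_k$ is the tree with one vertex of valency $k$ and $k$ vertices of valency $1$. $\mathbb{C}_n[\mathbf{w}]$ is the polynomial ring in commuting $w_{ij}$, $1\le i\ne j\le n$, modulo $w_{ij}=w_{ji}$. For a loopless graph $H$, $H_n=\frac{1}{|\mathrm{Aut}\,H|}\sum\prod_{\text{edges}}w_{ij}$ over injective vertex labelings by $\{1,\dots,n\}$, where $\mathrm{Aut}\,H$ is the group of half-edge permutations preserving edges and incidences. An $S_n$-invariant polynomial $P$ is uniquely $\sum_Hc_HH_n$ over loopless graphs without isolated vertices and with at most $n$ vertices; $c_H$ is the coefficient of $H$ in $P$. $\mathcal{W}$ is the algebra of families $(P_n)_{n\ge1}$ of $S_n$-invariant $P_n\in\mathbb{C}_n[\mathbf{w}]$ with bounded degrees and $P_n|_{w_{1n}=\dots=w_{n-1,n}=0}=P_{n-1}$. The family $(H_n)$ is denoted $H$, and every element of $\mathcal{W}$ is uniquely a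 finite combination $\sum C_HH$ over loopless graphs without isolated vertices. $T_n$ is the sum over spanning trees of the complete graph on $\{1,\dots,n\}$ of the products of $w_{ij}$ over their edges. $A_n$ has entries $(A_n)_{ii}=\sum_{j\ne i}w_{ij}$ and $(A_n)_{ij}=-w_{ij}$. $R_{g,n}$ is the degree-$2g$ part of $\det\phi(A_n)$ with $\phi(t)=\sinh(t/2)/(t/2)$, and $R_g=(R_{g,n})_n\in\mathcal{W}$. -}

module Defs where

open import Data.Bool using (Bool; true; false; _∧_; _∨_; not; if_then_else_)
open import Data.Nat as ℕ using (ℕ; zero; suc; _∸_; _≤_; _^_; _!)
open import Data.Fin as Fin using (Fin; punchIn; toℕ)
open import Data.Fin.Properties using () renaming (_≟_ to _≟F_; _<?_ to _<?F_)
open import Data.Vec as Vec using (Vec; tabulate; lookup)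
open import Data.Vec.Properties as VecP using ()
open import Data.List as List using (List; []; _∷_; [_]; _++_; concatMap; map; filter; length; allFin; upTo; foldr)
open import Data.List.Relation.Unary.All using (All)
open import Data.Product using (Σ; ∃; _×_; _,_; proj₁; proj₂)
open import Data.Rational as ℚ using (ℚ; 0ℚ; 1ℚ)
open import Data.Integer using (+_)
open import Function.Bundles using (_⤖_; Bijection)
open import Relation.Binary.PropositionalEquality using (_≡_)
open import Relation.Nullary.Decidable using (⌊_⌋; _×-dec_)
open import Relation.Nullary using (¬_)

-- 1/d as a rational, for d ≥ 1 (junk value 0 at d = 0; only used with d ≥ 1)
recip : ℕ → ℚ
recip zero    = 0ℚ
recip (suc d) = (+ 1) ℚ./ (suc d)

fromℕℚ : ℕ → ℚ
fromℕℚ k = (+ k) ℚ./ 1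

signℚ : ℕ → ℚ
signℚ zero    = 1ℚ
signℚ (suc k) = ℚ.- signℚ k

sumℕ : List ℕ → ℕ
sumℕ = foldr ℕ._+_ 0

prodℕ : List ℕ → ℕ
prodℕ = foldr ℕ._*_ 1

allB : List Bool → Bool
allB = foldr _∧_ true

anyB : List Bool → Bool
anyB = foldr _∨_ false

infix 4 _==_ _==F_ _<ᵇF_
_==_ : ℕ → ℕ → Bool
a == b = ⌊ a ℕ.≟ b ⌋

_<ᵇF_ : ∀ {n} → Fin n → Fin n → Bool
i <ᵇF j = ⌊ i <?F j ⌋

_==F_ : ∀ {n} → Fin n → Fin n → Bool
i ==F j = ⌊ i ≟F j ⌋

allVecs : ∀ {A : Set} → List A → (k : ℕ) → List (Vec A k)
allVecs xs zero    = [ Vec.[] ]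
allVecs xs (suc k) = concatMap (λ x → map (x Vec.∷_) (allVecs xs k)) xs

-- Loopless multigraphs on the vertex set Fin n: G i j = number of edges
-- between i and j.

Multigraph : ℕ → Set
Multigraph n = Fin n → Fin n → ℕ

record IsMultigraph {n : ℕ} (G : Multigraph n) : Set where
  field
    symmetric : ∀ i j → G i j ≡ G j i
    loopless  : ∀ i → G i i ≡ 0

edgeCount : ∀ {n} → Multigraph n → ℕ
edgeCount {n} G =
  sumℕ (concatMap (λ i → map (λ j → if i <ᵇF j then G i j else 0) (allFin n)) (allFin n))

degIn : ∀ {n} → Multigraph n → (Fin n → Bool) → Fin n → ℕ
degIn {n} G S v = sumℕ (map (λ u → if S u then G v u else 0) (allFin n))

reach : ∀ {n} → Multigraph n → Fin n → ℕ → Fin n → Bool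
reach G i zero    j = i ==F j
reach {n} G i (suc t) j =
  reach G i t j ∨ anyB (map (λ u → reach G i t u ∧ not (G u j == 0)) (allFin n))

connectedᵇ : ∀ {n} → Multigraph n → Bool
connectedᵇ {n} G = allB (concatMap (λ i → map (λ j → reach G i n j) (allFin n)) (allFin n))

Connected : ∀ {n} → Multigraph n → Set
Connected G = connectedᵇ G ≡ true

-- first Betti number E - V + 1 of a connected graph
betti₁ : ∀ {n} → Multigraph n → ℕ
betti₁ {n} G = (edgeCount G ℕ.+ 1) ∸ n

-- skeleton: repeatedly remove all valency-1 vertices (n rounds suffice)
core : ∀ {n} → Multigraph n → ℕ → Fin n → Bool
core G zero    v = true
core G (suc t) v = core G t v ∧ not (degIn G (core G t) v == 1)

skeleton : ∀ {n} → Multigraph n → Fin n → Bool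
skeleton {n} G = core G n

Essential : ∀ {n} → Multigraph n → Fin n → Set
Essential G v = (skeleton G v ≡ true) × (3 ≤ degIn G (skeleton G) v)

record IsLong {n : ℕ} (G : Multigraph n) : Set where
  field
    multigraph   : IsMultigraph G
    connected    : Connected G
    twoCycles    : 2 ≤ betti₁ G
    nonadjacent  : ∀ i j → Essential G i → Essential G j → G i j ≡ 0

NoIsolated : ∀ {n} → Multigraph n → Set
NoIsolated {n} G = ∀ a → ∃ λ b → 1 ≤ G a b

-- Disjoint unions of spiders X_{k₁} ⊔ … ⊔ X_{k_r}  (all kᵢ ≥ 1).
-- Vertices of the union: (i , p) with i a spider index and p ∈ Fin (1 + kᵢ);
-- p = 0 is the centre, p ≥ 1 are the leaves.

SpiderVertex : List ℕ → Set
SpiderVertex ks = Σ (Fin (length ks)) λ i → Fin (suc (List.lookup ks i))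

spiderEdges : (ks : List ℕ) → SpiderVertex ks → SpiderVertex ks → ℕ
spiderEdges ks (i , p) (j , q) =
  if (i ==F j) ∧ (((toℕ p == 0) ∧ not (toℕ q == 0)) ∨ ((toℕ q == 0) ∧ not (toℕ p == 0)))
  then 1 else 0

IsSpiderUnion : ∀ {k} → Multigraph k → Set
IsSpiderUnion {k} H =
  Σ (List ℕ) λ ks → All (1 ≤_) ks ×
    Σ (Fin k ⤖ SpiderVertex ks) λ σ →
      ∀ a b → H a b ≡ spiderEdges ks (Bijection.to σ a) (Bijection.to σ b)

-- A monomial is an n×n exponent matrix, nonzero only strictly above the diagonal;
-- entry (i , j), i < j, is the exponent of w_ij = w_ji.
-- A polynomial is a finite formal sum (list of terms); equality is coefficientwise.

Mono : ℕ → Set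
Mono n = Vec (Vec ℕ n) n

upper : ∀ {n} → (Fin n → Fin n → ℕ) → Mono n
upper f = tabulate λ i → tabulate λ j → if i <ᵇF j then f i j else 0

entry : ∀ {n} → Mono n → Fin n → Fin n → ℕ
entry m i j = lookup (lookup m i) j

graphOf : ∀ {n} → Mono n → Multigraph n
graphOf m i j = if i <ᵇF j then entry m i j else (if j <ᵇF i then entry m j i else 0)

isUpper : ∀ {n} → Mono n → Bool
isUpper {n} m = allB (concatMap (λ i → map (λ j → if i <ᵇF j then true else entry m i j == 0)
                                         (allFin n)) (allFin n))

monoMul : ∀ {n} → Mono n → Mono n → Mono n
monoMul = Vec.zipWith (Vec.zipWith ℕ._+_)

degree : ∀ {n} → Mono n → ℕ
degree m = Vec.sum (Vec.map Vec.sum m)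

Poly : ℕ → Set
Poly n = List (ℚ × Mono n)

coeff : ∀ {n} → Poly n → Mono n → ℚ
coeff []            m = 0ℚ
coeff ((c , a) ∷ p) m = (if ⌊ VecP.≡-dec (VecP.≡-dec ℕ._≟_) a m ⌋ then c else 0ℚ) ℚ.+ coeff p m

_≈P_ : ∀ {n} → Poly n → Poly n → Set
p ≈P q = ∀ m → coeff p m ≡ coeff q m

0P : ∀ {n} → Poly n
0P = []

1P : ∀ {n} → Poly n
1P = [ (1ℚ , Vec.replicate _ (Vec.replicate _ 0)) ]

_+P_ : ∀ {n} → Poly n → Poly n → Poly n
_+P_ = _++_

_*P_ : ∀ {n} → Poly n → Poly n → Poly n
p *P q = concatMap (λ t → map (λ s → (proj₁ t ℚ.* proj₁ s , monoMul (proj₂ t) (proj₂ s))) q) p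

scaleP : ∀ {n} → ℚ → Poly n → Poly n
scaleP c = map (λ s → (c ℚ.* proj₁ s , proj₂ s))

homPart : ∀ {n} → ℕ → Poly n → Poly n
homPart d = filter (λ s → degree (proj₂ s) ℕ.≟ d)

var : ∀ {n} → Fin n → Fin n → Poly n
var i j = [ (1ℚ , upper (λ a b → if ((a ==F i) ∧ (b ==F j)) ∨ ((a ==F j) ∧ (b ==F i)) then 1 else 0)) ]

sumFin : ∀ {n k} → (Fin k → Poly n) → Poly n
sumFin {k = k} f = concatMap f (allFin k)

Mat : ℕ → ℕ → Set
Mat n k = Fin k → Fin k → Poly n

matId : ∀ {n k} → Mat n k
matId i j = if i ==F j then 1P else 0P

matMul : ∀ {n k} → Mat n k → Mat n k → Mat n k
matMul M N i j = sumFin λ l → M i l *P N l j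

matPow : ∀ {n k} → Mat n k → ℕ → Mat n k
matPow M zero    = matId
matPow M (suc e) = matMul M (matPow M e)

det : ∀ {n k} → Mat n k → Poly n
det {k = zero}  M = 1P
det {k = suc k} M =
  sumFin λ j → scaleP (signℚ (toℕ j)) (M Fin.zero j *P det (λ a b → M (Fin.suc a) (punchIn j b)))

Amat : (n : ℕ) → Mat n n
Amat n i j = if i ==F j then sumFin (λ l → if l ==F i then 0P else var i l)
                        else scaleP (ℚ.- 1ℚ) (var i j)

-- φ(A) = Σ_k A^{2k} / (4^k (2k+1)!), truncated after k = g
-- (A has entries of degree 1, so terms with k > g only contribute in degree > 2g)
phiTrunc : ∀ {n} → ℕ → Mat n n → Mat n n
phiTrunc g M i j =
  concatMap (λ k → scaleP (recip (4 ^ k ℕ.* (suc (2 ℕ.* k)) !)) (matPow M (2 ℕ.* k) i j))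
            (upTo (suc g))

R : (g n : ℕ) → Poly n
R g n = homPart (2 ℕ.* g) (det (phiTrunc g (Amat n)))

allMonos01 : (n : ℕ) → List (Mono n)
allMonos01 n = allVecs (allVecs (0 ∷ 1 ∷ []) n) n

isSpanningTree : ∀ {n} → Mono n → Bool
isSpanningTree {n} m =
  isUpper m ∧ connectedᵇ (graphOf m) ∧ (edgeCount (graphOf m) ℕ.+ 1 == n)

T : (n : ℕ) → Poly n
T n = map (λ m → (1ℚ , m)) (List.filterᵇ isSpanningTree (allMonos01 n))

injectiveᵇ : ∀ {k m} → Vec (Fin m) k → Bool
injectiveᵇ {k} f =
  allB (concatMap (λ a → map (λ b → (a ==F b) ∨ not (lookup f a ==F lookup f b)) (allFin k)) (allFin k))

injections : (k m : ℕ) → List (Vec (Fin m) k)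
injections k m = List.filterᵇ injectiveᵇ (allVecs (allFin m) k)

push : ∀ {k m} → Vec (Fin m) k → Multigraph k → Mono m
push {k} f H = upper λ i j →
  sumℕ (concatMap (λ a → map (λ b → if (lookup f a ==F i) ∧ (lookup f b ==F j) then H a b else 0)
                             (allFin k)) (allFin k))

-- |Aut H| for a loopless graph without isolated vertices, Aut H acting on half-edges:
-- (number of vertex automorphisms) × Π_{a<b} (mult ab)!
autCount : ∀ {k} → Multigraph k → ℕ
autCount {k} H =
  length (List.filterᵇ (λ σ → injectiveᵇ σ ∧
            allB (concatMap (λ a → map (λ b → H (lookup σ a) (lookup σ b) == H a b) (allFin k)) (allFin k)))
          (allVecs (allFin k) k))
  ℕ.* prodℕ (concatMap (λ a → map (λ b → if a <ᵇF b then H a b ! else 1) (allFin k)) (allFin k))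

graphPoly : ∀ {k} → Multigraph k → (m : ℕ) → Poly m
graphPoly {k} H m = map (λ f → (recip (autCount H) , push f H)) (injections k m)

-- coefficient c_G of the graph G in an S_n-invariant polynomial P = Σ c_H H_n:
-- the monomial of G occurs in G_n with coefficient 1/Π_{i<j} (mult ij)!
coeffG : ∀ {n} → Multigraph n → Poly n → ℚ
coeffG {n} G P =
  fromℕℚ (prodℕ (concatMap (λ i → map (λ j → if i <ᵇF j then G i j ! else 1) (allFin n)) (allFin n)))
  ℚ.* coeff P (upper G)

-- Finite combinations Σ C_H H (elements of 𝒲)

record Term : Set where
  constructor term
  field
    size  : ℕ
    graph : Multigraph size
    coef  : ℚ

ValidTerm : Term → Set
ValidTerm t = IsMultigraph (Term.graph t) × NoIsolated (Term.graph t)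

SpiderTerm : Term → Set
SpiderTerm t = IsSpiderUnion (Term.graph t)

evalTerms : (n : ℕ) → List Term → Poly n
evalTerms n ts = concatMap (λ t → scaleP (Term.coef t) (graphPoly (Term.graph t) n)) ts

-- The monomial of G in T_n · H_n comes from a product (spanning tree) · (labelled copy of H), so
-- G is the edge-disjoint union of a spanning tree and a copy of H. Each edge of the copy closes a
-- cycle with the tree, hence its endpoints lie in the skeleton of G, each with a tree neighbour
-- there; a vertex of H with two distinct neighbours, or a double edge, is therefore essential in G.
-- As G is long, no edge of H joins two such vertices: H is simple and each of its edges has an end
-- of valency 1, i.e. H is a disjoint union of stars X_k. So non-spider terms of R_g contribute
-- nothing to the coefficient of G.

module Submission where

open import Defs
open import Algebra.Bundles using (CommutativeMonoid)
import Algebra.Properties.CommutativeSemigroup as CommutativeSemigroupProperties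
open import Data.Bool using (Bool; true; false; _∧_; _∨_; not; if_then_else_; T?)
open import Data.Bool.Properties using (T-≡; ∨-zeroʳ)
open import Data.Empty using (⊥; ⊥-elim)
open import Data.Fin as Fin using (Fin; zero; suc; toℕ; fromℕ<; punchOut)
open import Data.Fin.Properties as FinP
  using (any?; <-cmp; <-asym; <-irrefl; ≤-totalOrder; toℕ-fromℕ<; toℕ≤pred[n]; punchIn-punchOut)
open import Data.List as List using (List; []; _∷_; _++_; map; concatMap; allFin; filterᵇ; length)
open import Data.List.Properties using (map-tabulate; map-++; concatMap-++)
open import Data.List.Membership.Propositional using (_∈_; find)
open import Data.List.Membership.Propositional.Properties
  using (∈-map⁺; ∈-map⁻; ∈-allFin; ∈-concatMap⁺; ∈-concatMap⁻; ∈-filter⁺; ∈-filter⁻; ∈-lookup)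
open import Data.List.Relation.Unary.All as All using (All; _∷_)
open import Data.List.Relation.Unary.All.Properties as AllP using ()
open import Data.List.Relation.Unary.Any as Any using (here; there)
open import Data.List.Relation.Unary.Any.Properties using (lookup-index)
open import Data.List.Relation.Unary.Unique.Propositional using (Unique; _∷_)
open import Data.List.Relation.Unary.Unique.Propositional.Properties using (Unique[x∷xs]⇒x∉xs; filter⁺; allFin⁺)
open import Data.Nat as ℕ using (ℕ; zero; suc; _+_; _∸_; _*_; _≤_; _<_; z≤n; s≤s)
open import Data.Nat.Properties as ℕP using (m+n∸m≡n)
open import Data.Product using (∃; ∃₂; _×_; _,_; proj₁; proj₂)
open import Data.Rational as ℚ using (ℚ; 0ℚ; 1ℚ)
open import Data.Rational.Properties as ℚP using ()
open import Data.Sum using (_⊎_; inj₁; inj₂; [_,_]′)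
open import Data.Vec as Vec using (Vec; lookup; zipWith)
open import Data.Vec.Functional using (removeAt)
open import Data.Vec.Properties as VecP using (lookup∘tabulate; lookup-zipWith)
open import Function using (_∘_; id)
open import Function.Bundles using (Equivalence; _⤖_; mk↔ₛ′)
open import Function.Properties.Inverse using (↔⇒⤖)
open import Relation.Binary.Definitions using (tri<; tri≈; tri>)
open import Relation.Binary.PropositionalEquality
open import Relation.Nullary using (¬_; Dec; yes; no; contradiction)
open import Relation.Nullary.Decidable using (⌊_⌋; ¬?; _×-dec_)
open import Algebra.Properties.CommutativeMonoid.Sum ℕP.+-0-commutativeMonoid
  using (sum; sum-remove; ∑-distrib-+; sum-cong-≗)

private variable
  A : Set
  n k : ℕ

⌊⌋-true⁻ : (d : Dec A) → ⌊ d ⌋ ≡ true → A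
⌊⌋-true⁻ (yes a) _ = a

⌊⌋-false⁻ : (d : Dec A) → ⌊ d ⌋ ≡ false → ¬ A
⌊⌋-false⁻ (no ¬a) _ = ¬a

⌊⌋-true⁺ : (d : Dec A) → A → ⌊ d ⌋ ≡ true
⌊⌋-true⁺ (yes _) _  = refl
⌊⌋-true⁺ (no ¬a) a = contradiction a ¬a

⌊⌋-false⁺ : (d : Dec A) → ¬ A → ⌊ d ⌋ ≡ false
⌊⌋-false⁺ (yes a) ¬a = contradiction a ¬a
⌊⌋-false⁺ (no _)  _  = refl

∧-true⁻ : ∀ {x y} → x ∧ y ≡ true → x ≡ true × y ≡ true
∧-true⁻ {true} e = refl , e

∨-true⁻ : ∀ {x y} → x ∨ y ≡ true → x ≡ true ⊎ y ≡ true
∨-true⁻ {true}  _ = inj₁ refl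
∨-true⁻ {false} e = inj₂ e

not-true⁻ : ∀ {x} → not x ≡ true → x ≡ false
not-true⁻ {false} _ = refl

allB⁻ : ∀ {xs x} → allB xs ≡ true → x ∈ xs → x ≡ true
allB⁻ {y ∷ _} e (here refl) = proj₁ (∧-true⁻ {y} e)
allB⁻ {y ∷ _} e (there x∈)  = allB⁻ (proj₂ (∧-true⁻ {y} e)) x∈

anyB⁺ : ∀ {xs x} → x ∈ xs → x ≡ true → anyB xs ≡ true
anyB⁺ {true  ∷ _} _           _ = refl
anyB⁺ {false ∷ _} (here refl) ()
anyB⁺ {false ∷ _} (there x∈)  e = anyB⁺ x∈ e

anyB-map⁻ : (p : A → Bool) (xs : List A) → anyB (map p xs) ≡ true → ∃ λ x → x ∈ xs × p x ≡ true
anyB-map⁻ p (x ∷ xs) e with p x in px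
... | true  = x , here refl , px
... | false = let y , y∈ , py = anyB-map⁻ p xs e in y , there y∈ , py

∈-filterᵇ⁺ : (p : A → Bool) {x : A} {xs : List A} → x ∈ xs → p x ≡ true → x ∈ filterᵇ p xs
∈-filterᵇ⁺ p x∈ px = ∈-filter⁺ (T? ∘ p) x∈ (Equivalence.from T-≡ px)

∈-filterᵇ⁻ : (p : A → Bool) {x : A} (xs : List A) → x ∈ filterᵇ p xs → x ∈ xs × p x ≡ true
∈-filterᵇ⁻ p xs x∈ = let x∈xs , px = ∈-filter⁻ (T? ∘ p) {xs = xs} x∈ in x∈xs , Equivalence.to T-≡ px

∈-pairs : (f : Fin n → Fin n → A) (a b : Fin n) →
          f a b ∈ concatMap (λ i → map (f i) (allFin n)) (allFin n)
∈-pairs {n = n} f a b =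
  ∈-concatMap⁺ (λ i → map (f i) (allFin n)) (Any.map (λ { refl → ∈-map⁺ (f a) (∈-allFin b) }) (∈-allFin a))

∈⇒≤sumℕ : ∀ {xs x} → x ∈ xs → x ≤ sumℕ xs
∈⇒≤sumℕ {y ∷ xs} (here refl) = ℕP.m≤m+n y (sumℕ xs)
∈⇒≤sumℕ {y ∷ xs} (there x∈) = ℕP.≤-trans (∈⇒≤sumℕ x∈) (ℕP.m≤n+m (sumℕ xs) y)

sumℕ-tabulate : (f : Fin n → ℕ) → sumℕ (List.tabulate f) ≡ sum f
sumℕ-tabulate {zero}  f = refl
sumℕ-tabulate {suc n} f = cong (f Fin.zero +_) (sumℕ-tabulate (f ∘ Fin.suc))

sumℕ-allFin : (f : Fin n → ℕ) → sumℕ (map f (allFin n)) ≡ sum f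
sumℕ-allFin f = trans (cong sumℕ (map-tabulate id f)) (sumℕ-tabulate f)

≤-sum : (f : Fin n → ℕ) (i : Fin n) → f i ≤ sum f
≤-sum {suc n} f i rewrite sum-remove {i = i} f = ℕP.m≤m+n (f i) _

+-≤-sum : (f : Fin n → ℕ) {i j : Fin n} → i ≢ j → f i + f j ≤ sum f
+-≤-sum {suc n} f {i} {j} i≢j rewrite sum-remove {i = i} f =
  ℕP.+-monoʳ-≤ (f i) (subst (_≤ sum (removeAt f i)) (cong f (punchIn-punchOut i≢j))
                         (≤-sum (removeAt f i) (punchOut i≢j)))

sum-mono : {f g : Fin n → ℕ} → (∀ i → f i ≤ g i) → sum f ≤ sum g
sum-mono {zero}  _   = z≤n
sum-mono {suc n} f≤g = ℕP.+-mono-≤ (f≤g Fin.zero) (sum-mono (f≤g ∘ Fin.suc))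

_≟M_ : (a b : Mono n) → Dec (a ≡ b)
_≟M_ = VecP.≡-dec (VecP.≡-dec ℕ._≟_)

mulTerm : ℚ × Mono n → ℚ × Mono n → ℚ × Mono n
mulTerm (c , a) (d , b) = c ℚ.* d , monoMul a b

-- exponentwise truncated subtraction; it is the quotient M / a only when monoMul a (monoDiv M a) ≡ M
monoDiv : Mono n → Mono n → Mono n
monoDiv = zipWith (zipWith _∸_)

zipWith-cancel : (f g : A → A → A) → (∀ x y → g (f x y) x ≡ y) →
                 (xs ys : Vec A k) → zipWith g (zipWith f xs ys) xs ≡ ys
zipWith-cancel f g cancel Vec.[]       Vec.[]       = refl
zipWith-cancel f g cancel (x Vec.∷ xs) (y Vec.∷ ys) = cong₂ Vec._∷_ (cancel x y) (zipWith-cancel f g cancel xs ys)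

monoDiv-monoMul : (a b : Mono n) → monoDiv (monoMul a b) a ≡ b
monoDiv-monoMul = zipWith-cancel (zipWith _+_) (zipWith _∸_) (zipWith-cancel _+_ _∸_ m+n∸m≡n)

coeff-++ : (p q : Poly n) (M : Mono n) → coeff (p ++ q) M ≡ coeff p M ℚ.+ coeff q M
coeff-++ []            q M = sym (ℚP.+-identityˡ _)
coeff-++ ((c , a) ∷ p) q M = trans (cong (x ℚ.+_) (coeff-++ p q M)) (sym (ℚP.+-assoc x (coeff p M) (coeff q M)))
  where x = if ⌊ a ≟M M ⌋ then c else 0ℚ

coeff-absent : (p : Poly n) (M : Mono n) → (∀ {t} → t ∈ p → proj₂ t ≢ M) → coeff p M ≡ 0ℚ
coeff-absent []            M _      = refl
coeff-absent ((c , a) ∷ p) M absent with a ≟M M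
... | yes a≡M = contradiction a≡M (absent (here refl))
... | no  _   = trans (ℚP.+-identityˡ _) (coeff-absent p M (absent ∘ there))

coeff-translate : (c : ℚ) (a : Mono n) (q : Poly n) (M : Mono n) → monoMul a (monoDiv M a) ≡ M →
                  coeff (map (mulTerm (c , a)) q) M ≡ c ℚ.* coeff q (monoDiv M a)
coeff-translate c a []            M _     = sym (ℚP.*-zeroʳ c)
coeff-translate c a ((d , b) ∷ q) M a∣M
  with monoMul a b ≟M M | b ≟M monoDiv M a | coeff-translate c a q M a∣M
... | yes _    | yes _  | ih = trans (cong (c ℚ.* d ℚ.+_) ih) (sym (ℚP.*-distribˡ-+ c d _))
... | no  _    | no  _  | ih = trans (ℚP.+-identityˡ _) (trans ih (cong (c ℚ.*_) (sym (ℚP.+-identityˡ _))))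
... | yes ab≡M | no b≢  | _  = contradiction (trans (sym (monoDiv-monoMul a b)) (cong (λ x → monoDiv x a) ab≡M)) b≢
... | no ab≢M  | yes b≡ | _  = contradiction (trans (cong (monoMul a) b≡) a∣M) ab≢M

coeff-translate-absent : (c : ℚ) (a : Mono n) (q : Poly n) (M : Mono n) → monoMul a (monoDiv M a) ≢ M →
                         coeff (map (mulTerm (c , a)) q) M ≡ 0ℚ
coeff-translate-absent c a []            M _   = refl
coeff-translate-absent c a ((d , b) ∷ q) M a∤M with monoMul a b ≟M M
... | yes ab≡M = contradiction (trans (cong (monoMul a ∘ (λ x → monoDiv x a)) (sym ab≡M))
                                      (trans (cong (monoMul a) (monoDiv-monoMul a b)) ab≡M)) a∤M
... | no  _    = trans (ℚP.+-identityˡ _) (coeff-translate-absent c a q M a∤M)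

*P-congʳ : (p : Poly n) {q q′ : Poly n} → q ≈P q′ → (p *P q) ≈P (p *P q′)
*P-congʳ []            _    M = refl
*P-congʳ ((c , a) ∷ p) {q} {q′} q≈q′ M = begin
  coeff (map (mulTerm (c , a)) q ++ p *P q) M             ≡⟨ coeff-++ (map (mulTerm (c , a)) q) _ M ⟩
  coeff (map (mulTerm (c , a)) q) M ℚ.+ coeff (p *P q) M  ≡⟨ cong₂ ℚ._+_ translate-cong (*P-congʳ p q≈q′ M) ⟩
  coeff (map (mulTerm (c , a)) q′) M ℚ.+ coeff (p *P q′) M ≡⟨ coeff-++ (map (mulTerm (c , a)) q′) _ M ⟨
  coeff (map (mulTerm (c , a)) q′ ++ p *P q′) M           ∎
  where
  open ≡-Reasoning
  translate-cong : coeff (map (mulTerm (c , a)) q) M ≡ coeff (map (mulTerm (c , a)) q′) M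
  translate-cong with monoMul a (monoDiv M a) ≟M M
  ... | yes a∣M = trans (coeff-translate c a q M a∣M)
                        (trans (cong (c ℚ.*_) (q≈q′ _)) (sym (coeff-translate c a q′ M a∣M)))
  ... | no a∤M  = trans (coeff-translate-absent c a q M a∤M) (sym (coeff-translate-absent c a q′ M a∤M))

*P-distribˡ-++ : (p q r : Poly n) → (p *P (q ++ r)) ≈P ((p *P q) ++ (p *P r))
*P-distribˡ-++ []      q r M = refl
*P-distribˡ-++ (t ∷ p) q r M = begin
  coeff (map (mulTerm t) (q ++ r) ++ p *P (q ++ r)) M
    ≡⟨ coeff-++ (map (mulTerm t) (q ++ r)) _ M ⟩
  coeff (map (mulTerm t) (q ++ r)) M ℚ.+ coeff (p *P (q ++ r)) M
    ≡⟨ cong₂ ℚ._+_ (trans (cong (λ x → coeff x M) (map-++ (mulTerm t) q r)) (coeff-++ (map (mulTerm t) q) _ M))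
                   (trans (*P-distribˡ-++ p q r M) (coeff-++ (p *P q) _ M)) ⟩
  (coeff (map (mulTerm t) q) M ℚ.+ coeff (map (mulTerm t) r) M) ℚ.+ (coeff (p *P q) M ℚ.+ coeff (p *P r) M)
    ≡⟨ interchange (coeff (map (mulTerm t) q) M) (coeff (map (mulTerm t) r) M) (coeff (p *P q) M) (coeff (p *P r) M) ⟩
  (coeff (map (mulTerm t) q) M ℚ.+ coeff (p *P q) M) ℚ.+ (coeff (map (mulTerm t) r) M ℚ.+ coeff (p *P r) M)
    ≡⟨ cong₂ ℚ._+_ (coeff-++ (map (mulTerm t) q) _ M) (coeff-++ (map (mulTerm t) r) _ M) ⟨
  coeff (map (mulTerm t) q ++ p *P q) M ℚ.+ coeff (map (mulTerm t) r ++ p *P r) M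
    ≡⟨ coeff-++ (map (mulTerm t) q ++ p *P q) _ M ⟨
  coeff ((map (mulTerm t) q ++ p *P q) ++ (map (mulTerm t) r ++ p *P r)) M ∎
  where
  open ≡-Reasoning
  open CommutativeSemigroupProperties (CommutativeMonoid.commutativeSemigroup ℚP.+-0-commutativeMonoid)
    using (interchange)

<ᵇF-true : {i j : Fin n} → i Fin.< j → (i <ᵇF j) ≡ true
<ᵇF-true {i = i} {j} = ⌊⌋-true⁺ (i FinP.<? j)

<ᵇF-false : {i j : Fin n} → ¬ i Fin.< j → (i <ᵇF j) ≡ false
<ᵇF-false {i = i} {j} = ⌊⌋-false⁺ (i FinP.<? j)

entry-upper : (F : Fin n → Fin n → ℕ) (i j : Fin n) → entry (upper F) i j ≡ (if i <ᵇF j then F i j else 0)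
entry-upper F i j rewrite lookup∘tabulate (λ i → Vec.tabulate λ j → if i <ᵇF j then F i j else 0) i =
  lookup∘tabulate (λ j → if i <ᵇF j then F i j else 0) j

entry-monoMul : (a b : Mono n) (i j : Fin n) → entry (monoMul a b) i j ≡ entry a i j + entry b i j
entry-monoMul a b i j rewrite lookup-zipWith (zipWith _+_) i a b = lookup-zipWith _+_ j (lookup a i) (lookup b i)

graphOf-< : (m : Mono n) {i j : Fin n} → i Fin.< j → graphOf m i j ≡ entry m i j
graphOf-< m i<j rewrite <ᵇF-true i<j = refl

graphOf-> : (m : Mono n) {i j : Fin n} → j Fin.< i → graphOf m i j ≡ entry m j i
graphOf-> m j<i rewrite <ᵇF-false (<-asym j<i) | <ᵇF-true j<i = refl

graphOf-diag : (m : Mono n) (i : Fin n) → graphOf m i i ≡ 0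
graphOf-diag m i rewrite <ᵇF-false (<-irrefl {x = i} refl) = refl

graphOf-monoMul : (a b : Mono n) (i j : Fin n) → graphOf (monoMul a b) i j ≡ graphOf a i j + graphOf b i j
graphOf-monoMul a b i j with <-cmp i j
... | tri< i<j _ _ rewrite graphOf-< (monoMul a b) i<j | graphOf-< a i<j | graphOf-< b i<j = entry-monoMul a b i j
... | tri> _ _ j<i rewrite graphOf-> (monoMul a b) j<i | graphOf-> a j<i | graphOf-> b j<i = entry-monoMul a b j i
... | tri≈ _ refl _ rewrite graphOf-diag (monoMul a b) i | graphOf-diag a i | graphOf-diag b i = refl

graphOf-upper-< : (F : Fin n → Fin n → ℕ) {i j : Fin n} → i Fin.< j → graphOf (upper F) i j ≡ F i j
graphOf-upper-< F {i} {j} i<j rewrite graphOf-< (upper F) i<j | entry-upper F i j | <ᵇF-true i<j = refl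

graphOf-upper-> : (F : Fin n → Fin n → ℕ) {i j : Fin n} → j Fin.< i → graphOf (upper F) i j ≡ F j i
graphOf-upper-> F {i} {j} j<i rewrite graphOf-> (upper F) j<i | entry-upper F j i | <ᵇF-true j<i = refl

graphOf-upper : {G : Multigraph n} → IsMultigraph G → ∀ i j → graphOf (upper G) i j ≡ G i j
graphOf-upper {G = G} mg i j with <-cmp i j
... | tri< i<j _ _  = graphOf-upper-< G i<j
... | tri> _ _ j<i  = trans (graphOf-upper-> G j<i) (IsMultigraph.symmetric mg j i)
... | tri≈ _ refl _ = trans (graphOf-diag (upper G) i) (sym (IsMultigraph.loopless mg i))

graph-split : {G : Multigraph n} → IsMultigraph G → (a b : Mono n) → monoMul a b ≡ upper G →
              ∀ i j → graphOf a i j + graphOf b i j ≡ G i j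
graph-split mg a b ab≡G i j =
  trans (sym (graphOf-monoMul a b i j)) (trans (cong (λ m → graphOf m i j) ab≡G) (graphOf-upper mg i j))

injectiveᵇ-sound : (f : Vec (Fin n) k) → injectiveᵇ f ≡ true → ∀ a b → lookup f a ≡ lookup f b → a ≡ b
injectiveᵇ-sound f inj a b fa≡fb
  with ∨-true⁻ (allB⁻ inj (∈-pairs (λ a b → (a ==F b) ∨ not (lookup f a ==F lookup f b)) a b))
... | inj₁ a≟b   = ⌊⌋-true⁻ (a FinP.≟ b) a≟b
... | inj₂ fa≢fb = contradiction fa≡fb (⌊⌋-false⁻ (lookup f a FinP.≟ lookup f b) (not-true⁻ fa≢fb))

-- push f H is upper (pushed f H) by definition
pushed : Vec (Fin n) k → Multigraph k → Fin n → Fin n → ℕ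
pushed {k = k} f H i j =
  sumℕ (concatMap (λ a → map (λ b → if (lookup f a ==F i) ∧ (lookup f b ==F j) then H a b else 0)
                             (allFin k)) (allFin k))

≤-pushed : (f : Vec (Fin n) k) (H : Multigraph k) (a b : Fin k) → H a b ≤ pushed f H (lookup f a) (lookup f b)
≤-pushed f H a b = subst (_≤ pushed f H (lookup f a) (lookup f b)) summand≡ (∈⇒≤sumℕ (∈-pairs summand a b))
  where
  summand : Fin _ → Fin _ → ℕ
  summand a′ b′ = if (lookup f a′ ==F lookup f a) ∧ (lookup f b′ ==F lookup f b) then H a′ b′ else 0
  summand≡ : summand a b ≡ H a b
  summand≡ rewrite ⌊⌋-true⁺ (lookup f a FinP.≟ lookup f a) refl
                 | ⌊⌋-true⁺ (lookup f b FinP.≟ lookup f b) refl = refl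

graphOf-push-≥ : (f : Vec (Fin n) k) → injectiveᵇ f ≡ true → {H : Multigraph k} → IsMultigraph H →
                 ∀ a b → H a b ≤ graphOf (push f H) (lookup f a) (lookup f b)
graphOf-push-≥ f inj {H} mg a b with <-cmp (lookup f a) (lookup f b)
... | tri< fa<fb _ _ = subst (H a b ≤_) (sym (graphOf-upper-< (pushed f H) fa<fb)) (≤-pushed f H a b)
... | tri> _ _ fb<fa = subst (H a b ≤_) (sym (graphOf-upper-> (pushed f H) fb<fa))
                             (subst (_≤ pushed f H (lookup f b) (lookup f a)) (IsMultigraph.symmetric mg b a)
                                    (≤-pushed f H b a))
... | tri≈ _ fa≡fb _ with injectiveᵇ-sound f inj a b fa≡fb
...   | refl rewrite IsMultigraph.loopless mg a = z≤n

module Distance {n : ℕ} (E : Multigraph n) (u : Fin n) where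

  private
    r : ℕ → Fin n → Bool
    r = reach E u

  reach-suc : ∀ t {y} → r t y ≡ true → r (suc t) y ≡ true
  reach-suc t {y} e rewrite e = refl

  reach-mono : ∀ {s t y} → s ≤ t → r s y ≡ true → r t y ≡ true
  reach-mono {s} {t} s≤t e with ℕP.≤⇒≤′ s≤t
  ... | ℕ.≤′-refl       = e
  ... | ℕ.≤′-step {n = t′} s≤′t′ = reach-suc t′ (reach-mono (ℕP.≤′⇒≤ s≤′t′) e)

  reach-step : ∀ t {z y} → r t z ≡ true → 1 ≤ E z y → r (suc t) y ≡ true
  reach-step t {z} {y} e z~y =
    trans (cong (r t y ∨_) (anyB⁺ (∈-map⁺ (λ w → r t w ∧ not (E w y == 0)) (∈-allFin z)) step))
          (∨-zeroʳ (r t y))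
    where
    step : (r t z ∧ not (E z y == 0)) ≡ true
    step rewrite e | ⌊⌋-false⁺ (E z y ℕ.≟ 0) (λ e′ → ℕP.<⇒≢ z~y (sym e′)) = refl

  reach-step⁻ : ∀ {t y} → r (suc t) y ≡ true → r t y ≡ false → ∃ λ z → r t z ≡ true × 1 ≤ E z y
  reach-step⁻ {t} {y} e f rewrite f with anyB-map⁻ (λ w → r t w ∧ not (E w y == 0)) (allFin n) e
  ... | z , _ , step with ∧-true⁻ {r t z} step
  ...   | rz , z~y = z , rz , ℕP.n≢0⇒n>0 (⌊⌋-false⁻ (E z y ℕ.≟ 0) (not-true⁻ z~y))

  AtDistance : ℕ → Fin n → Set
  AtDistance t y = r t y ≡ true × (∀ s → s < t → r s y ≡ false)

  atDistance-zero : ∀ {y} → AtDistance 0 y → u ≡ y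
  atDistance-zero (e , _) = ⌊⌋-true⁻ (u FinP.≟ _) e

  atDistance-unique : ∀ {s t y} → AtDistance s y → AtDistance t y → s ≡ t
  atDistance-unique {s} {t} (rs , fs) (rt , ft) with ℕP.<-cmp s t
  ... | tri< s<t _ _ = contradiction (trans (sym rs) (ft s s<t)) λ ()
  ... | tri≈ _ s≡t _ = s≡t
  ... | tri> _ _ t<s = contradiction (trans (sym rt) (fs t t<s)) λ ()

  atDistance-exists : ∀ {t y} → r t y ≡ true → ∃ λ D → AtDistance D y
  atDistance-exists {zero}  e = 0 , e , λ _ ()
  atDistance-exists {suc t} {y} e = by-cases (r t y) refl
    where
    by-cases : ∀ b → r t y ≡ b → ∃ λ D → AtDistance D y
    by-cases true  e′ = atDistance-exists {t} e′
    by-cases false e′ = suc t , e , λ s s<1+t → earlier s (ℕP.≤-pred s<1+t)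
      where
      earlier : ∀ s → s ≤ t → r s y ≡ false
      earlier s s≤t with r s y in es
      ... | false = refl
      ... | true  = trans (sym (reach-mono s≤t es)) e′

  atDistance-pred : ∀ {t y} → AtDistance (suc t) y → ∃ λ z → AtDistance t z × 1 ≤ E z y
  atDistance-pred {t} {y} (e , f) with reach-step⁻ {t} e (f t (ℕP.n<1+n t))
  ... | z , rz , z~y = z , (rz , earlier) , z~y
    where
    earlier : ∀ s → s < t → r s z ≡ false
    earlier s s<t with r s z in es
    ... | false = refl
    ... | true  = trans (sym (reach-step s es z~y)) (f (suc s) (s≤s s<t))

  record Geodesic (D : ℕ) (v : Fin n) : Set where
    field
      vertex   : ℕ → Fin n
      ends     : vertex D ≡ v
      distance : ∀ i → i ≤ D → AtDistance i (vertex i)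
      adjacent : ∀ i → i < D → 1 ≤ E (vertex i) (vertex (suc i))

    starts : vertex 0 ≡ u
    starts = sym (atDistance-zero (distance 0 z≤n))

    vertex-injective : ∀ {i j} → i ≤ D → j ≤ D → vertex i ≡ vertex j → i ≡ j
    vertex-injective i≤D j≤D e = atDistance-unique (distance _ i≤D) (subst (AtDistance _) (sym e) (distance _ j≤D))

  geodesic : ∀ {D v} → AtDistance D v → Geodesic D v
  geodesic {zero} {v} at = record
    { vertex = λ _ → v ; ends = refl ; distance = λ { zero _ → at } ; adjacent = λ _ () }
  geodesic {suc t} {v} at with atDistance-pred at
  ... | z , atz , z~v = record
    { vertex = vertex ; ends = ends ; distance = distance ; adjacent = adjacent }
    where
    module P = Geodesic (geodesic atz)
    vertex : ℕ → Fin n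
    vertex i with i ℕ.≤? t
    ... | yes _ = P.vertex i
    ... | no  _ = v
    vertex-≤ : ∀ {i} → i ≤ t → vertex i ≡ P.vertex i
    vertex-≤ {i} i≤t with i ℕ.≤? t
    ... | yes _   = refl
    ... | no  i≰t = contradiction i≤t i≰t
    ends : vertex (suc t) ≡ v
    ends with suc t ℕ.≤? t
    ... | yes 1+t≤t = contradiction 1+t≤t (ℕP.n≮n t)
    ... | no  _     = refl
    distance : ∀ i → i ≤ suc t → AtDistance i (vertex i)
    distance i i≤1+t with ℕP.m≤n⇒m<n∨m≡n i≤1+t
    ... | inj₁ (s≤s i≤t) = subst (AtDistance i) (sym (vertex-≤ i≤t)) (P.distance i i≤t)
    ... | inj₂ refl      = subst (AtDistance (suc t)) (sym ends) at
    adjacent : ∀ i → i < suc t → 1 ≤ E (vertex i) (vertex (suc i))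
    adjacent i (s≤s i≤t) with ℕP.m≤n⇒m<n∨m≡n i≤t
    ... | inj₁ i<t = subst₂ (λ a b → 1 ≤ E a b) (sym (vertex-≤ i≤t)) (sym (vertex-≤ i<t)) (P.adjacent i i<t)
    ... | inj₂ refl = subst₂ (λ a b → 1 ≤ E a b) (sym (trans (vertex-≤ i≤t) P.ends)) (sym ends) z~v

module _ (G : Multigraph n) where

  private
    summand : (Fin n → Bool) → Fin n → Fin n → ℕ
    summand S v a = if S a then G v a else 0

    summand-in : ∀ S v {a} → S a ≡ true → summand S v a ≡ G v a
    summand-in S v {a} Sa rewrite Sa = refl

  degIn-sum : ∀ S v → degIn G S v ≡ sum (summand S v)
  degIn-sum S v = sumℕ-allFin (summand S v)

  ≤-degIn : ∀ S v {a} → S a ≡ true → G v a ≤ degIn G S v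
  ≤-degIn S v {a} Sa = subst₂ _≤_ (summand-in S v Sa) (sym (degIn-sum S v)) (≤-sum (summand S v) a)

  +-≤-degIn : ∀ S v {a b} → a ≢ b → S a ≡ true → S b ≡ true → G v a + G v b ≤ degIn G S v
  +-≤-degIn S v a≢b Sa Sb =
    subst₂ _≤_ (cong₂ _+_ (summand-in S v Sa) (summand-in S v Sb)) (sym (degIn-sum S v)) (+-≤-sum (summand S v) a≢b)

  degIn-mono : ∀ {S S′} v → (∀ a → S a ≡ true → S′ a ≡ true) → degIn G S v ≤ degIn G S′ v
  degIn-mono {S} {S′} v S⊆S′ = subst₂ _≤_ (sym (degIn-sum S v)) (sym (degIn-sum S′ v)) (sum-mono pointwise)
    where
    pointwise : ∀ a → summand S v a ≤ summand S′ v a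
    pointwise a with S a in Sa
    ... | false = z≤n
    ... | true  rewrite S⊆S′ a Sa = ℕP.≤-refl

  two-neighbours : ∀ S v {a b} → S a ≡ true → S b ≡ true → 1 ≤ G v a → 1 ≤ G v b →
                   (a ≡ b → 2 ≤ G v a) → 2 ≤ degIn G S v
  two-neighbours S v {a} {b} Sa Sb va vb double with a FinP.≟ b
  ... | yes a≡b = ℕP.≤-trans (double a≡b) (≤-degIn S v Sa)
  ... | no  a≢b = ℕP.≤-trans (ℕP.+-mono-≤ va vb) (+-≤-degIn S v a≢b Sa Sb)

  core-⊇ : (C : Fin n → Bool) → (∀ y → C y ≡ true → 2 ≤ degIn G C y) →
           ∀ t y → C y ≡ true → core G t y ≡ true
  core-⊇ C deg≥2 zero    y Cy = refl
  core-⊇ C deg≥2 (suc t) y Cy =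
    cong₂ (λ a b → a ∧ not b) (core-⊇ C deg≥2 t y Cy) (⌊⌋-false⁺ (degIn G (core G t) y ℕ.≟ 1) deg≢1)
    where
    deg≢1 : degIn G (core G t) y ≢ 1
    deg≢1 e = ℕP.<-irrefl (sym e) (ℕP.≤-trans (deg≥2 y Cy) (degIn-mono y (core-⊇ C deg≥2 t)))

degIn-+ : (G₁ G₂ G : Multigraph n) (S : Fin n → Bool) (v : Fin n) → (∀ a → G₁ v a + G₂ v a ≡ G v a) →
          degIn G₁ S v + degIn G₂ S v ≡ degIn G S v
degIn-+ G₁ G₂ G S v split = begin
  degIn G₁ S v + degIn G₂ S v       ≡⟨ cong₂ _+_ (degIn-sum G₁ S v) (degIn-sum G₂ S v) ⟩
  sum (s₁) + sum (s₂)               ≡⟨ ∑-distrib-+ s₁ s₂ ⟨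
  sum (λ a → s₁ a + s₂ a)           ≡⟨ sum-cong-≗ pointwise ⟩
  sum (λ a → if S a then G v a else 0) ≡⟨ degIn-sum G S v ⟨
  degIn G S v                       ∎
  where
  open ≡-Reasoning
  s₁ s₂ : Fin _ → ℕ
  s₁ a = if S a then G₁ v a else 0
  s₂ a = if S a then G₂ v a else 0
  pointwise : ∀ a → s₁ a + s₂ a ≡ (if S a then G v a else 0)
  pointwise a with S a
  ... | true  = split a
  ... | false = refl

module _ (G : Multigraph n) (G-sym : ∀ x y → G x y ≡ G y x)
         (E : Multigraph n) (E≤G : ∀ x y → E x y ≤ G x y) (E-connected : connectedᵇ E ≡ true) where

  -- An edge uv of G beyond those of the connected spanning subgraph E closes a cycle: the
  -- vertices of a shortest E-path from u to v all have valency ≥ 2 among themselves.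
  chord-in-skeleton : ∀ {u v} → u ≢ v → E u v + 1 ≤ G u v →
                      skeleton G u ≡ true × ∃ λ x → skeleton G x ≡ true × 1 ≤ E u x
  chord-in-skeleton {u} {v} u≢v chord
    with Distance.atDistance-exists E u {n} (allB⁻ E-connected (∈-pairs (λ i j → reach E i n j) u v))
  ... | zero    , at = contradiction (Distance.atDistance-zero E u at) u≢v
  ... | suc D′  , at = subst (λ x → skeleton G x ≡ true) starts (in-skeleton (on-path z≤n)) ,
                       vertex 1 , in-skeleton (on-path (s≤s z≤n)) , u~p₁
    where
    open Distance E u
    open Geodesic (geodesic at)
    D = suc D′

    onPath? : (y : Fin n) → Dec (∃ λ (i : Fin (suc D)) → vertex (toℕ i) ≡ y)
    onPath? y = any? (λ i → vertex (toℕ i) FinP.≟ y)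

    OnPath : Fin n → Bool
    OnPath y = ⌊ onPath? y ⌋

    on-path : ∀ {i} → i ≤ D → OnPath (vertex i) ≡ true
    on-path {i} i≤D = ⌊⌋-true⁺ (onPath? (vertex i)) (fromℕ< (s≤s i≤D) , cong vertex (toℕ-fromℕ< (s≤s i≤D)))

    E⇒G : ∀ {x y} → 1 ≤ E x y → 1 ≤ G x y
    E⇒G {x} {y} e = ℕP.≤-trans e (E≤G x y)

    E⇒G-flip : ∀ {x y} → 1 ≤ E x y → 1 ≤ G y x
    E⇒G-flip {x} {y} e = subst (1 ≤_) (G-sym x y) (E⇒G e)

    double : ∀ {x y} → x ≡ u → y ≡ v → 1 ≤ E x y → 2 ≤ G x y
    double refl refl e = ℕP.≤-trans (ℕP.+-monoˡ-≤ 1 e) chord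

    u~p₁ : 1 ≤ E u (vertex 1)
    u~p₁ = subst (λ x → 1 ≤ E x (vertex 1)) starts (adjacent 0 (s≤s z≤n))

    G-uv : 1 ≤ G (vertex 0) (vertex D)
    G-uv = subst₂ (λ x y → 1 ≤ G x y) (sym starts) (sym ends) (ℕP.≤-trans (ℕP.m≤n+m 1 (E u v)) chord)

    valency : ∀ i → i ≤ D → 2 ≤ degIn G OnPath (vertex i)
    valency zero _ = two-neighbours G OnPath (vertex 0) (on-path (s≤s z≤n)) (on-path ℕP.≤-refl)
      (E⇒G (adjacent 0 (s≤s z≤n))) G-uv
      (λ e → double starts (trans e ends) (adjacent 0 (s≤s z≤n)))
    valency (suc j) j<D with suc j ℕ.≟ D
    ... | yes refl = two-neighbours G OnPath (vertex D) (on-path (ℕP.n≤1+n D′)) (on-path z≤n)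
      (E⇒G-flip (adjacent D′ ℕP.≤-refl)) (subst (1 ≤_) (G-sym _ _) G-uv)
      (λ e → subst (2 ≤_) (G-sym _ _) (double (trans e starts) ends (adjacent D′ ℕP.≤-refl)))
    ... | no  1+j≢D = two-neighbours G OnPath (vertex (suc j))
      (on-path (ℕP.m≤n⇒m≤1+n (ℕP.≤-pred j<D))) (on-path 2+j≤D)
      (E⇒G-flip (adjacent j j<D)) (E⇒G (adjacent (suc j) 2+j≤D))
      (λ e → contradiction (vertex-injective (ℕP.m≤n⇒m≤1+n (ℕP.≤-pred j<D)) 2+j≤D e) (ℕP.m≢1+n+m j {1}))
      where
      2+j≤D : suc j < D
      2+j≤D = ℕP.≤∧≢⇒< j<D 1+j≢D

    in-skeleton : ∀ {y} → OnPath y ≡ true → skeleton G y ≡ true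
    in-skeleton {y} = core-⊇ G OnPath on-path-valency n y
      where
      on-path-valency : ∀ y → OnPath y ≡ true → 2 ≤ degIn G OnPath y
      on-path-valency y p with ⌊⌋-true⁻ (onPath? y) p
      ... | i , refl = valency (toℕ i) (toℕ≤pred[n] i)

Branching : Multigraph k → Fin k → Set
Branching H a = ∃₂ λ b c → b ≢ c × 1 ≤ H a b × 1 ≤ H a c

record IsStarForest (H : Multigraph k) : Set where
  field
    multigraph            : IsMultigraph H
    noIsolated            : NoIsolated H
    simple                : ∀ a b → H a b ≤ 1
    branching-nonadjacent : ∀ a b → 1 ≤ H a b → Branching H a → Branching H b → ⊥

module StarForest {k : ℕ} {H : Multigraph k} (star : IsStarForest H) where

  open IsStarForest star
  open IsMultigraph multigraph
  open import Algebra.Construct.NaturalChoice.Min (≤-totalOrder k) using (_⊓_; ⊓-comm; ⊓-sel)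

  private
    sym-edge : ∀ {a b} → 1 ≤ H a b → 1 ≤ H b a
    sym-edge {a} {b} = subst (1 ≤_) (symmetric a b)

    edge⇒≢ : ∀ {a b} → 1 ≤ H a b → a ≢ b
    edge⇒≢ {a} h refl = ℕP.<-irrefl (sym (loopless a)) h

  branching? : ∀ a → Dec (Branching H a)
  branching? a = any? λ b → any? λ c → ¬? (b FinP.≟ c) ×-dec (1 ℕ.≤? H a b) ×-dec (1 ℕ.≤? H a c)

  neighbour : Fin k → Fin k
  neighbour a = proj₁ (noIsolated a)

  neighbour-adjacent : ∀ a → 1 ≤ H a (neighbour a)
  neighbour-adjacent a = proj₂ (noIsolated a)

  only-neighbour : ∀ {a b} → ¬ Branching H a → 1 ≤ H a b → neighbour a ≡ b
  only-neighbour {a} {b} ¬br h with neighbour a FinP.≟ b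
  ... | yes e  = e
  ... | no  ne = contradiction (neighbour a , b , ne , neighbour-adjacent a , h) ¬br

  -- the centre of the star containing a; an isolated edge is centred at its smaller end
  hub : Fin k → Fin k
  hub a with branching? a | branching? (neighbour a)
  ... | yes _ | _     = a
  ... | no  _ | yes _ = neighbour a
  ... | no  _ | no  _ = a ⊓ neighbour a

  hub-branching : ∀ {a} → Branching H a → hub a ≡ a
  hub-branching {a} br with branching? a
  ... | yes _  = refl
  ... | no ¬br = contradiction br ¬br

  hub-leaf : ∀ {a b} → ¬ Branching H a → Branching H b → 1 ≤ H a b → hub a ≡ b
  hub-leaf {a} {b} ¬br brb h with branching? a | only-neighbour ¬br h
  ... | yes bra | _    = contradiction bra ¬br
  ... | no  _   | refl with branching? (neighbour a)
  ...   | yes _    = refl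
  ...   | no ¬brb = contradiction brb ¬brb

  hub-pair : ∀ {a b} → ¬ Branching H a → ¬ Branching H b → 1 ≤ H a b → hub a ≡ a ⊓ b
  hub-pair {a} {b} ¬br ¬brb h with branching? a | only-neighbour ¬br h
  ... | yes bra | _    = contradiction bra ¬br
  ... | no  _   | refl with branching? (neighbour a)
  ...   | yes brb = contradiction brb ¬brb
  ...   | no  _   = refl

  hub-adjacent : ∀ {a b} → 1 ≤ H a b → hub a ≡ hub b
  hub-adjacent {a} {b} h = by-cases (branching? a) (branching? b)
    where
    by-cases : Dec (Branching H a) → Dec (Branching H b) → hub a ≡ hub b
    by-cases (yes bra) (yes brb) = ⊥-elim (branching-nonadjacent a b h bra brb)
    by-cases (yes bra) (no ¬brb) = trans (hub-branching bra) (sym (hub-leaf ¬brb bra (sym-edge h)))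
    by-cases (no ¬bra) (yes brb) = trans (hub-leaf ¬bra brb h) (sym (hub-branching brb))
    by-cases (no ¬bra) (no ¬brb) =
      trans (hub-pair ¬bra ¬brb h) (trans (⊓-comm a b) (sym (hub-pair ¬brb ¬bra (sym-edge h))))

  hub-endpoint : ∀ {a b} → 1 ≤ H a b → hub a ≡ a ⊎ hub b ≡ b
  hub-endpoint {a} {b} h = by-cases (branching? a) (branching? b)
    where
    by-cases : Dec (Branching H a) → Dec (Branching H b) → hub a ≡ a ⊎ hub b ≡ b
    by-cases (yes bra) _         = inj₁ (hub-branching bra)
    by-cases (no _)    (yes brb) = inj₂ (hub-branching brb)
    by-cases (no ¬bra) (no ¬brb) with ⊓-sel a b
    ... | inj₁ a⊓b≡a = inj₁ (trans (hub-pair ¬bra ¬brb h) a⊓b≡a)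
    ... | inj₂ a⊓b≡b = inj₂ (trans (sym (hub-adjacent h)) (trans (hub-pair ¬bra ¬brb h) a⊓b≡b))

  adjacent-hub : ∀ {a} → hub a ≢ a → 1 ≤ H a (hub a)
  adjacent-hub {a} hub≢a with hub-endpoint (neighbour-adjacent a)
  ... | inj₁ e = contradiction e hub≢a
  ... | inj₂ e = subst (λ c → 1 ≤ H a c) (trans (sym e) (sym (hub-adjacent (neighbour-adjacent a)))) (neighbour-adjacent a)

  hub-idempotent : ∀ a → hub (hub a) ≡ hub a
  hub-idempotent a with hub a FinP.≟ a
  ... | yes e    = cong hub e
  ... | no hub≢a = sym (hub-adjacent (adjacent-hub hub≢a))

  centre-has-leaf : ∀ c → hub c ≡ c → ∃ λ a → hub a ≡ c × a ≢ c
  centre-has-leaf c centre = neighbour c , trans (sym (hub-adjacent (neighbour-adjacent c))) centre ,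
                               edge⇒≢ (neighbour-adjacent c) ∘ sym

  non-edge : ∀ {a b} → ¬ 1 ≤ H a b → H a b ≡ 0
  non-edge {a} {b} ¬h = ℕP.n≤0⇒n≡0 (ℕP.≮⇒≥ ¬h)

  edge : ∀ {a b} → 1 ≤ H a b → H a b ≡ 1
  edge {a} {b} h = ℕP.≤-antisym (simple a b) h

  edge-to-centre : ∀ {a b} → hub b ≡ a → b ≢ a → H a b ≡ 1
  edge-to-centre {a} {b} hub≡a b≢a =
    edge (sym-edge (subst (λ c → 1 ≤ H b c) hub≡a (adjacent-hub λ e → b≢a (trans (sym e) hub≡a))))

  no-edge-between-stars : ∀ {a b} → hub a ≢ hub b → H a b ≡ 0
  no-edge-between-stars hub≢ = non-edge (hub≢ ∘ hub-adjacent)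

  no-edge-between-leaves : ∀ {a b} → hub a ≢ a → hub b ≢ b → H a b ≡ 0
  no-edge-between-leaves ¬ca ¬cb = non-edge λ h → [ ¬ca , ¬cb ]′ (hub-endpoint h)

lookup-injective : ∀ {A : Set} {xs : List A} → Unique xs → ∀ i j → List.lookup xs i ≡ List.lookup xs j → i ≡ j
lookup-injective {xs = x ∷ xs} _         zero    zero    _ = refl
lookup-injective {xs = x ∷ xs} u         zero    (suc j) e =
  contradiction (subst (_∈ xs) (sym e) (∈-lookup j)) (Unique[x∷xs]⇒x∉xs u)
lookup-injective {xs = x ∷ xs} u         (suc i) zero    e =
  contradiction (subst (_∈ xs) e (∈-lookup i)) (Unique[x∷xs]⇒x∉xs u)
lookup-injective {xs = x ∷ xs} (_ ∷ u)   (suc i) (suc j) e = cong suc (lookup-injective u i j e)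

-- An idempotent map r on Fin k splits Fin k into its fibres over the fixed points; the fibre of the
-- fixed point c is numbered by c itself (position 0) followed by the other points of the fibre.
module Fibres {k : ℕ} (r : Fin k → Fin k) (r-idempotent : ∀ a → r (r a) ≡ r a) where

  Centre : Fin k → Set
  Centre c = r c ≡ c

  centres : List (Fin k)
  centres = filterᵇ (λ c → r c ==F c) (allFin k)

  leaves : Fin k → List (Fin k)
  leaves c = filterᵇ (λ a → (r a ==F c) ∧ not (a ==F c)) (allFin k)

  sizes : List (Fin k) → List ℕ
  sizes = map (length ∘ leaves)

  member : (cs : List (Fin k)) → SpiderVertex (sizes cs) → Fin k
  member (c ∷ cs) (zero  , zero)  = c
  member (c ∷ cs) (zero  , suc q) = List.lookup (leaves c) q
  member (c ∷ cs) (suc i , p)     = member cs (i , p)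

  leaf-lookup : ∀ c q → r (List.lookup (leaves c) q) ≡ c × List.lookup (leaves c) q ≢ c
  leaf-lookup c q with ∈-filterᵇ⁻ (λ a → (r a ==F c) ∧ not (a ==F c)) (allFin k) (∈-lookup {xs = leaves c} q)
  ... | _ , in-fibre with ∧-true⁻ {r _ ==F c} in-fibre
  ...   | r≡c , ≢c = ⌊⌋-true⁻ (_ FinP.≟ c) r≡c , ⌊⌋-false⁻ (_ FinP.≟ c) (not-true⁻ ≢c)

  ∈-leaves : ∀ {a c} → r a ≡ c → a ≢ c → a ∈ leaves c
  ∈-leaves {a} {c} r≡c a≢c = ∈-filterᵇ⁺ (λ a → (r a ==F c) ∧ not (a ==F c)) (∈-allFin a)
    (cong₂ (λ x y → x ∧ not y) (⌊⌋-true⁺ (r a FinP.≟ c) r≡c) (⌊⌋-false⁺ (a FinP.≟ c) a≢c))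

  unique-leaves : ∀ c → Unique (leaves c)
  unique-leaves c = filter⁺ _ (allFin⁺ k)

  r-member : ∀ cs → All Centre cs → ∀ i p → r (member cs (i , p)) ≡ member cs (i , zero)
  r-member (c ∷ cs) (c-centre ∷ _) zero    zero    = c-centre
  r-member (c ∷ cs) _              zero    (suc q) = proj₁ (leaf-lookup c q)
  r-member (c ∷ cs) (_ ∷ rest)     (suc i) p       = r-member cs rest i p

  member-leaf : ∀ cs i q → member cs (i , suc q) ≢ member cs (i , zero)
  member-leaf (c ∷ cs) zero    q = proj₂ (leaf-lookup c q)
  member-leaf (c ∷ cs) (suc i) q = member-leaf cs i q

  member-∈ : ∀ cs i → member cs (i , zero) ∈ cs
  member-∈ (c ∷ cs) zero    = here refl
  member-∈ (c ∷ cs) (suc i) = there (member-∈ cs i)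

  member-index-injective : ∀ {cs} → Unique cs → ∀ i j → member cs (i , zero) ≡ member cs (j , zero) → i ≡ j
  member-index-injective {c ∷ cs} _       zero    zero    _ = refl
  member-index-injective {c ∷ cs} u       zero    (suc j) e =
    contradiction (subst (_∈ cs) (sym e) (member-∈ cs j)) (Unique[x∷xs]⇒x∉xs u)
  member-index-injective {c ∷ cs} u       (suc i) zero    e =
    contradiction (subst (_∈ cs) e (member-∈ cs i)) (Unique[x∷xs]⇒x∉xs u)
  member-index-injective {c ∷ cs} (_ ∷ u) (suc i) (suc j) e = cong suc (member-index-injective u i j e)

  member-position-injective : ∀ cs i p p′ → member cs (i , p) ≡ member cs (i , p′) → p ≡ p′
  member-position-injective (c ∷ cs) zero    zero    zero     _ = refl
  member-position-injective (c ∷ cs) zero    zero    (suc q′) e = contradiction (sym e) (member-leaf (c ∷ cs) zero q′)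
  member-position-injective (c ∷ cs) zero    (suc q) zero     e = contradiction e (member-leaf (c ∷ cs) zero q)
  member-position-injective (c ∷ cs) zero    (suc q) (suc q′) e = cong suc (lookup-injective (unique-leaves c) q q′ e)
  member-position-injective (c ∷ cs) (suc i) p       p′       e = member-position-injective cs i p p′ e

  member-injective : ∀ {cs} → All Centre cs → Unique cs → ∀ s t → member cs s ≡ member cs t → s ≡ t
  member-injective {cs} all-centre u (i , p) (j , p′) e
    with member-index-injective u i j (trans (sym (r-member cs all-centre i p)) (trans (cong r e) (r-member cs all-centre j p′)))
  ... | refl = cong (i ,_) (member-position-injective cs i p p′ e)

  member-surjective : ∀ cs a → r a ∈ cs → ∃ λ s → member cs s ≡ a
  member-surjective (c ∷ cs) a (here r≡c) with a FinP.≟ c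
  ... | yes refl = (zero , zero) , refl
  ... | no  a≢c  = (zero , suc (Any.index a∈)) , sym (lookup-index a∈)
    where
    a∈ : a ∈ leaves c
    a∈ = ∈-leaves r≡c a≢c
  member-surjective (c ∷ cs) a (there r∈) = let (i , p) , e = member-surjective cs a r∈ in (suc i , p) , e

  centres-centre : All Centre centres
  centres-centre = All.tabulate λ {c} c∈ →
    ⌊⌋-true⁻ (r c FinP.≟ c) (proj₂ (∈-filterᵇ⁻ (λ c → r c ==F c) (allFin k) c∈))

  unique-centres : Unique centres
  unique-centres = filter⁺ _ (allFin⁺ k)

  r∈centres : ∀ a → r a ∈ centres
  r∈centres a = ∈-filterᵇ⁺ (λ c → r c ==F c) (∈-allFin (r a)) (⌊⌋-true⁺ (r (r a) FinP.≟ r a) (r-idempotent a))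

  position : Fin k → SpiderVertex (sizes centres)
  position a = proj₁ (member-surjective centres a (r∈centres a))

  member-position : ∀ a → member centres (position a) ≡ a
  member-position a = proj₂ (member-surjective centres a (r∈centres a))

  position-bijection : Fin k ⤖ SpiderVertex (sizes centres)
  position-bijection = ↔⇒⤖ (mk↔ₛ′ position (member centres) position-member member-position)
    where
    position-member : ∀ s → position (member centres s) ≡ s
    position-member s = member-injective centres-centre unique-centres _ s (member-position (member centres s))

  sizes-positive : (∀ c → Centre c → ∃ λ a → r a ≡ c × a ≢ c) → All (1 ≤_) (sizes centres)
  sizes-positive has-leaf = AllP.map⁺ (All.map nonempty centres-centre)
    where
    nonempty : ∀ {c} → Centre c → 1 ≤ length (leaves c)
    nonempty {c} c-centre with has-leaf c c-centre
    ... | a , r≡c , a≢c with leaves c | ∈-leaves r≡c a≢c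
    ...   | _ ∷ _ | _ = s≤s z≤n

module _ {G : Multigraph n} (long : IsLong G) (m : Mono n) (tree : isSpanningTree m ≡ true)
         {H : Multigraph k} (H-multigraph : IsMultigraph H) (f : Vec (Fin n) k) (inj : injectiveᵇ f ≡ true)
         (factor : monoMul m (push f H) ≡ upper G) where

  private
    open IsLong long
    open IsMultigraph multigraph renaming (symmetric to G-sym)
    open IsMultigraph H-multigraph renaming (symmetric to H-sym; loopless to H-loopless)
    E = graphOf m
    P = graphOf (push f H)
    F = lookup f
    S = skeleton G

    E+P≡G : ∀ x y → E x y + P x y ≡ G x y
    E+P≡G = graph-split multigraph m (push f H) factor

    H≤P : ∀ a b → H a b ≤ P (F a) (F b)
    H≤P = graphOf-push-≥ f inj H-multigraph

    H⇒G : ∀ {a b} → 1 ≤ H a b → 1 ≤ G (F a) (F b)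
    H⇒G {a} {b} h =
      ℕP.≤-trans h (ℕP.≤-trans (H≤P a b) (subst (P (F a) (F b) ≤_) (E+P≡G (F a) (F b)) (ℕP.m≤n+m _ _)))

    F-injective : ∀ {a b} → F a ≡ F b → a ≡ b
    F-injective = injectiveᵇ-sound f inj _ _

    E-connected : connectedᵇ E ≡ true
    E-connected = proj₁ (∧-true⁻ (proj₂ (∧-true⁻ {isUpper m} tree)))

    endpoint-in-skeleton : ∀ {a b} → 1 ≤ H a b → S (F a) ≡ true × ∃ λ x → S x ≡ true × 1 ≤ E (F a) x
    endpoint-in-skeleton {a} {b} h = chord-in-skeleton G G-sym E (λ x y → subst (E x y ≤_) (E+P≡G x y) (ℕP.m≤m+n _ _))
      E-connected Fa≢Fb (subst (E (F a) (F b) + 1 ≤_) (E+P≡G (F a) (F b)) (ℕP.+-monoʳ-≤ _ (ℕP.≤-trans h (H≤P a b))))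
      where
      Fa≢Fb : F a ≢ F b
      Fa≢Fb e with F-injective e
      ... | refl = ℕP.<-irrefl (sym (H-loopless a)) h

    neighbour-in-skeleton : ∀ {a b} → 1 ≤ H a b → S (F b) ≡ true
    neighbour-in-skeleton {a} {b} h = proj₁ (endpoint-in-skeleton (subst (1 ≤_) (H-sym a b) h))

  -- valency ≥ 3 in the skeleton: an edge of the spanning tree plus the H-edges towards b and c
  essential : ∀ a b c → 1 ≤ H a b → 1 ≤ H a c → (b ≡ c → 2 ≤ H a b) → Essential G (F a)
  essential a b c hb hc double with endpoint-in-skeleton hb
  ... | Sa , x , Sx , e = Sa , subst (3 ≤_) (degIn-+ E P G S (F a) (E+P≡G (F a)))
    (ℕP.+-mono-≤ (ℕP.≤-trans e (≤-degIn E S (F a) Sx))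
      (two-neighbours P S (F a) (neighbour-in-skeleton hb) (neighbour-in-skeleton hc)
        (ℕP.≤-trans hb (H≤P a b)) (ℕP.≤-trans hc (H≤P a c))
        (λ e → ℕP.≤-trans (double (F-injective e)) (H≤P a b))))

  cofactor-starForest : NoIsolated H → IsStarForest H
  cofactor-starForest noIsolated = record
    { multigraph            = H-multigraph
    ; noIsolated            = noIsolated
    ; simple                = simple
    ; branching-nonadjacent = branching-nonadjacent
    }
    where
    essential-edge-absurd : ∀ {a b} → 1 ≤ H a b → Essential G (F a) → Essential G (F b) → ⊥
    essential-edge-absurd {a} {b} h ea eb = ℕP.<-irrefl (sym (nonadjacent (F a) (F b) ea eb)) (H⇒G h)

    simple : ∀ a b → H a b ≤ 1
    simple a b with H a b ℕ.≤? 1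
    ... | yes h≤1 = h≤1
    ... | no  h≰1 = contradiction (essential-edge-absurd h
                      (essential a b b h h (λ _ → ℕP.≰⇒> h≰1))
                      (essential b a a h′ h′ (λ _ → subst (2 ≤_) (H-sym a b) (ℕP.≰⇒> h≰1)))) λ ()
      where
      h : 1 ≤ H a b
      h = ℕP.≤-trans (s≤s z≤n) (ℕP.≰⇒> h≰1)
      h′ : 1 ≤ H b a
      h′ = subst (1 ≤_) (H-sym a b) h

    branching-nonadjacent : ∀ a b → 1 ≤ H a b → Branching H a → Branching H b → ⊥
    branching-nonadjacent a b h (c , d , c≢d , hc , hd) (c′ , d′ , c′≢d′ , hc′ , hd′) =
      essential-edge-absurd h (essential a c d hc hd (λ e → contradiction e c≢d))
                              (essential b c′ d′ hc′ hd′ (λ e → contradiction e c′≢d′))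

starForest⇒spiderUnion : {H : Multigraph k} → IsStarForest H → IsSpiderUnion H
starForest⇒spiderUnion {k} {H} star =
  sizes centres , sizes-positive centre-has-leaf , position-bijection , λ a b →
    subst₂ (λ x y → H x y ≡ spiderEdges (sizes centres) (position a) (position b))
           (member-position a) (member-position b) (member-edges (position a) (position b))
  where
  open StarForest star
  open Fibres hub hub-idempotent
  open IsMultigraph (IsStarForest.multigraph star)

  hub-member : ∀ i p → hub (member centres (i , p)) ≡ member centres (i , zero)
  hub-member = r-member centres centres-centre

  leaf-not-centre : ∀ i q → hub (member centres (i , suc q)) ≢ member centres (i , suc q)
  leaf-not-centre i q e = member-leaf centres i q (trans (sym e) (hub-member i (suc q)))

  member-edges : ∀ s t → H (member centres s) (member centres t) ≡ spiderEdges (sizes centres) s t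
  member-edges (i , p) (j , q) with i FinP.≟ j
  ... | no i≢j = no-edge-between-stars λ e →
          i≢j (member-index-injective unique-centres i j (trans (sym (hub-member i p)) (trans e (hub-member j q))))
  ... | yes refl = same-star p q
    where
    same-star : ∀ p q → H (member centres (i , p)) (member centres (i , q)) ≡
                (if ((toℕ p == 0) ∧ not (toℕ q == 0)) ∨ ((toℕ q == 0) ∧ not (toℕ p == 0)) then 1 else 0)
    same-star zero    zero    = loopless _
    same-star zero    (suc q) = edge-to-centre (hub-member i (suc q)) (member-leaf centres i q)
    same-star (suc p) zero    = trans (symmetric _ _) (edge-to-centre (hub-member i (suc p)) (member-leaf centres i p))
    same-star (suc p) (suc q) = no-edge-between-leaves (leaf-not-centre i p) (leaf-not-centre i q)

∈-*P⁻ : {p q : Poly n} {t : ℚ × Mono n} → t ∈ p *P q → ∃₂ λ u v → u ∈ p × v ∈ q × t ≡ mulTerm u v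
∈-*P⁻ {p = p} {q} t∈ with find (∈-concatMap⁻ (λ u → map (mulTerm u) q) {xs = p} t∈)
... | u , u∈ , t∈uq with ∈-map⁻ (mulTerm u) t∈uq
...   | v , v∈ , refl = u , v , u∈ , v∈ , refl

∈-T⁻ : {u : ℚ × Mono n} → u ∈ T n → isSpanningTree (proj₂ u) ≡ true
∈-T⁻ {n} u∈ with ∈-map⁻ (λ m → (1ℚ , m)) u∈
... | m , m∈ , refl = proj₂ (∈-filterᵇ⁻ isSpanningTree (allMonos01 n) m∈)

∈-evalTerms⁻ : {ts : List Term} {v : ℚ × Mono n} → v ∈ evalTerms n ts →
               ∃ λ τ → τ ∈ ts × ∃ λ (f : Vec (Fin n) (Term.size τ)) →
                 injectiveᵇ f ≡ true × proj₂ v ≡ push f (Term.graph τ)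
∈-evalTerms⁻ {n} {ts} v∈
  with find (∈-concatMap⁻ (λ τ → scaleP (Term.coef τ) (graphPoly (Term.graph τ) n)) {xs = ts} v∈)
... | τ , τ∈ , v∈τ with ∈-map⁻ _ v∈τ
...   | w , w∈ , refl with ∈-map⁻ _ w∈
...     | f , f∈ , refl = τ , τ∈ , f , proj₂ (∈-filterᵇ⁻ injectiveᵇ (allVecs (allFin n) (Term.size τ)) f∈) , refl

cofactor-spider : {G : Multigraph n} → IsLong G → (m : Mono n) → isSpanningTree m ≡ true →
                         (τ : Term) → ValidTerm τ → (f : Vec (Fin n) (Term.size τ)) → injectiveᵇ f ≡ true →
                         monoMul m (push f (Term.graph τ)) ≡ upper G → SpiderTerm τ
cofactor-spider long m tree τ (multigraph , noIsolated) f inj factor =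
  starForest⇒spiderUnion (cofactor-starForest long m tree multigraph f inj factor noIsolated)

coeff-nonspider : {G : Multigraph n} → IsLong G → (ts : List Term) → All ValidTerm ts →
                  All (λ τ → ¬ SpiderTerm τ) ts → coeff (T n *P evalTerms n ts) (upper G) ≡ 0ℚ
coeff-nonspider {n} {G} long ts valid nonspider = coeff-absent (T n *P evalTerms n ts) (upper G) absent
  where
  absent : ∀ {t} → t ∈ T n *P evalTerms n ts → proj₂ t ≢ upper G
  absent t∈ factor with ∈-*P⁻ t∈
  ... | u , v , u∈ , v∈ , refl with ∈-evalTerms⁻ v∈
  ...   | τ , τ∈ , f , inj , refl =
    All.lookup nonspider τ∈ (cofactor-spider long (proj₂ u) (∈-T⁻ u∈) τ (All.lookup valid τ∈) f inj factor)

coeffG-cong : (G : Multigraph n) (p q : Poly n) → coeff p (upper G) ≡ coeff q (upper G) → coeffG G p ≡ coeffG G q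
coeffG-cong G p q e rewrite e = refl

lemma1 : (g n : ℕ) (G : Multigraph n) → IsLong G → betti₁ G ≡ 2 * g →
         (Ls Lo : List Term) →
         All ValidTerm (Ls ++ Lo) →
         All SpiderTerm Ls → All (λ t → ¬ SpiderTerm t) Lo →
         (∀ m → R g m ≈P evalTerms m (Ls ++ Lo)) →
         coeffG G (T n *P R g n) ≡ coeffG G (T n *P evalTerms n Ls)
lemma1 g n G long _ Ls Lo valid _ nonspider R≈ = coeffG-cong G (T n *P R g n) (T n *P evalTerms n Ls) (begin
  coeff (T n *P R g n) M                                    ≡⟨ *P-congʳ (T n) (R≈ n) M ⟩
  coeff (T n *P evalTerms n (Ls ++ Lo)) M                   ≡⟨ cong (λ p → coeff (T n *P p) M) (concatMap-++ _ Ls Lo) ⟩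
  coeff (T n *P (spiders ++ others)) M                      ≡⟨ *P-distribˡ-++ (T n) spiders others M ⟩
  coeff (T n *P spiders ++ T n *P others) M                 ≡⟨ coeff-++ (T n *P spiders) (T n *P others) M ⟩
  coeff (T n *P spiders) M ℚ.+ coeff (T n *P others) M      ≡⟨ cong (coeff (T n *P spiders) M ℚ.+_) others-vanish ⟩
  coeff (T n *P spiders) M ℚ.+ 0ℚ                           ≡⟨ ℚP.+-identityʳ (coeff (T n *P spiders) M) ⟩
  coeff (T n *P spiders) M                                  ∎)
  where
  open ≡-Reasoning
  M = upper G
  spiders others : Poly n
  spiders = evalTerms n Ls
  others  = evalTerms n Lo
  others-vanish : coeff (T n *P others) M ≡ 0ℚ
  others-vanish = coeff-nonspider long Lo (AllP.++⁻ʳ Ls valid) nonspider
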